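{- (1) $h(n,P_4)\ge 3(n-3)$. (2) $h(n,P_7)\ge h(n,P_6)\ge h(n,P_5)\ge 3n-6$. (3) $h(n,P_{2m+1})\ge h(n,P_{2m})\ge m(n-m)$ for all $m\ge 4$.
   Context: $P_k$ denotes the path on $k$ vertices. For a graph $H$, $F_{H,1}$ is the set of maps $f:E(H)\to E(H)$ with $f(e)\ne e$ for all $e$. A subgraph $G'$ of $H$ is $f$-free if $f(e)\notin E(G')$ for all $e\in E(G')$. $h(n,G)$ is the maximum number of edges of an $n$-vertex graph $H$ for which some $f\in F_{H,1}$ exists with no $f$-free copy of $G$ in $H$. -}

module Defs where

open import Data.Nat using (ℕ; suc; _≤_)
open import Data.Fin using (Fin; toℕ) renaming (_<_ to _<ᶠ_)
open import Data.Product using (Σ; Σ-syntax; _×_; _,_; proj₁; proj₂)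
open import Data.Sum using (_⊎_)
open import Relation.Binary.PropositionalEquality using (_≡_; _≢_)
open import Relation.Nullary using (¬_)
open import Function.Definitions using (Injective)

-- A finite simple graph on vertex set Fin n.  Its edges are indexed by
-- Fin (nEdges H); edge e = (u , v) with u < v encodes the unordered
-- edge {u , v}; distinct indices give distinct edges.
record Graph (n : ℕ) : Set where
  field
    nEdges   : ℕ
    edge     : Fin nEdges → Fin n × Fin n
    ordered  : ∀ e → proj₁ (edge e) <ᶠ proj₂ (edge e)
    distinct : Injective _≡_ _≡_ edge
open Graph public

Joins : ∀ {n} (H : Graph n) → Fin (nEdges H) → Fin n → Fin n → Set
Joins H e u v = (edge H e ≡ (u , v)) ⊎ (edge H e ≡ (v , u))

-- A copy of the path P_k (k vertices) in H: distinct vertices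
-- vert 0, ..., vert (k-1), and for consecutive i, j (toℕ j = 1 + toℕ i)
-- an edge of H joining vert i and vert j.
record PathCopy {n : ℕ} (H : Graph n) (k : ℕ) : Set where
  field
    vert    : Fin k → Fin n
    vertInj : Injective _≡_ _≡_ vert
    edg     : (i j : Fin k) → toℕ j ≡ suc (toℕ i) → Fin (nEdges H)
    joins   : (i j : Fin k) (p : toℕ j ≡ suc (toℕ i)) → Joins H (edg i j p) (vert i) (vert j)
open PathCopy public

FFree : ∀ {n k} {H : Graph n} → (Fin (nEdges H) → Fin (nEdges H)) → PathCopy H k → Set
FFree f P = ∀ i j p i' j' p' → f (edg P i j p) ≢ edg P i' j' p'

-- H is admissible for P_k: some f ∈ F_{H,1} admits no f-free copy of P_k
Admissible : ∀ {n} → ℕ → Graph n → Set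
Admissible k H =
  Σ[ f ∈ (Fin (nEdges H) → Fin (nEdges H)) ]
    ((∀ e → f e ≢ e) × ((P : PathCopy H k) → ¬ FFree f P))

-- h(n, P_k) ≥ b
hAtLeast : ℕ → ℕ → ℕ → Set
hAtLeast n k b = Σ[ H ∈ Graph n ] (b ≤ nEdges H × Admissible k H)

-- h(n, P_k) ≥ h(n, P_l)
hGe : ℕ → ℕ → ℕ → Set
hGe n k l = (H : Graph n) → Admissible l H →
  Σ[ H' ∈ Graph n ] (nEdges H ≤ nEdges H' × Admissible k H')

-- All three bounds come from joins: a small class A, an independent class B and
-- all edges between them (for P₅ also a triangle on A).  The map f sends the
-- edge ab to σ(a)b for a fixed-point-free σ on A and rotates the triangle.  A
-- path with a B-vertex between a and a' is then not f-free once σ a = a' or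
-- σ a' = a.
-- For P₄ and P₅, |A| = 3 and σ is a 3-cycle, which links any two distinct
-- vertices; every P₄ has an interior B-vertex, and a P₅ whose three interior
-- vertices lie in A uses two distinct triangle edges in a row, which the
-- rotation links.
-- For P₂ₘ, A = {0, …, m-1} is edgeless and σ sends every a ≠ 0 to 0, so 0 lies
-- on no f-free path with at least four vertices.  But each of the m pairs of
-- consecutive positions 2t, 2t+1 of a P₂ₘ holds a vertex of A, giving m
-- distinct vertices of A ∖ {0}.
module Submission where

open import Defs
open import Data.Empty using (⊥; ⊥-elim)
open import Data.Fin
  using (Fin; suc; toℕ; fromℕ<; splitAt; combine; cast; punchOut; inject₁; _↑ˡ_; _↑ʳ_)
  renaming (_<_ to _<ᶠ_)
open import Data.Fin.Patterns using (0F; 1F; 2F; 3F; 4F)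
import Data.Fin.Properties as Finₚ
open import Data.Nat using (ℕ; suc; _+_; _*_; _∸_; _≤_; _<_; z≤n; s≤s; _≤?_)
import Data.Nat.Properties as ℕₚ
open import Data.Product using (Σ-syntax; ∃-syntax; _×_; _,_; proj₁; proj₂)
open import Data.Product.Properties using (,-injective)
open import Data.Sum using (_⊎_; inj₁; inj₂)
open import Data.Sum.Function.Propositional using (_⊎-↔_)
open import Function using (_∘_)
open import Function.Bundles using (_↔_; Inverse; Injection)
open import Function.Definitions using (Injective)
open import Function.Properties.Inverse using (↔-refl; ↔-trans; Inverse⇒Injection)
open import Relation.Binary.PropositionalEquality
open import Relation.Nullary using (¬_; yes; no)

Linked : ∀ {A : Set} → (A → A) → A → A → Set
Linked φ x y = φ x ≡ y ⊎ φ y ≡ x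

Linked-map : ∀ {A B : Set} {φ : A → A} {ψ : B → B} (g : A → B) → (∀ x → ψ (g x) ≡ g (φ x)) →
  ∀ {x y} → Linked φ x y → Linked ψ (g x) (g y)
Linked-map g commutes (inj₁ hit) = inj₁ (trans (commutes _) (cong g hit))
Linked-map g commutes (inj₂ hit) = inj₂ (trans (commutes _) (cong g hit))

emptyGraph : (n : ℕ) → Graph n
emptyGraph n = record { nEdges = 0 ; edge = λ () ; ordered = λ () ; distinct = λ { {()} } }

record Triple (K : ℕ) : Set where
  constructor triple
  field
    left mid right : Fin K
    left-mid  : toℕ mid ≡ suc (toℕ left)
    mid-right : toℕ right ≡ suc (toℕ mid)
open Triple

tripleAt : ∀ {K} x → 2 + x < K → Triple K
tripleAt x 2+x<K = triple (fromℕ< x<K) (fromℕ< 1+x<K) (fromℕ< 2+x<K)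
  (trans (Finₚ.toℕ-fromℕ< 1+x<K) (cong suc (sym (Finₚ.toℕ-fromℕ< x<K))))
  (trans (Finₚ.toℕ-fromℕ< 2+x<K) (cong suc (sym (Finₚ.toℕ-fromℕ< 1+x<K))))
  where
  1+x<K = ℕₚ.<-trans (ℕₚ.n<1+n _) 2+x<K
  x<K   = ℕₚ.<-trans (ℕₚ.n<1+n _) 1+x<K

triple-around : ∀ {K} → 4 ≤ K → (q : Fin K) → Σ[ t ∈ Triple K ] (left t ≡ q ⊎ right t ≡ q)
triple-around 4≤K q with toℕ q in eq
... | 0 = tripleAt 0 3≤K , inj₁ (Finₚ.toℕ-injective (trans (Finₚ.toℕ-fromℕ< _) (sym eq)))
  where 3≤K = ℕₚ.≤-trans (s≤s (s≤s (s≤s z≤n))) 4≤K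
... | 1 = tripleAt 1 4≤K , inj₁ (Finₚ.toℕ-injective (trans (Finₚ.toℕ-fromℕ< _) (sym eq)))
... | suc (suc x) = tripleAt x (subst (_< _) eq (Finₚ.toℕ<n q))
                  , inj₂ (Finₚ.toℕ-injective (trans (Finₚ.toℕ-fromℕ< _) (sym eq)))

module _ {n K} {H : Graph n} (P : PathCopy H K) where

  leftEdge rightEdge : Triple K → Fin (nEdges H)
  leftEdge t  = edg P (left t) (mid t) (left-mid t)
  rightEdge t = edg P (mid t) (right t) (mid-right t)

  vert-distinct : ∀ {i j} → toℕ i ≢ toℕ j → vert P i ≢ vert P j
  vert-distinct i≢j = i≢j ∘ cong toℕ ∘ vertInj P

  module _ (t : Triple K) where
    private
      l<m : toℕ (left t) < toℕ (mid t)
      l<m = ℕₚ.≤-reflexive (sym (left-mid t))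
      m<r : toℕ (mid t) < toℕ (right t)
      m<r = ℕₚ.≤-reflexive (sym (mid-right t))

    ends-distinct : vert P (left t) ≢ vert P (right t)
    ends-distinct = vert-distinct (ℕₚ.<⇒≢ (ℕₚ.<-trans l<m m<r))

    consecutive-edges-distinct : leftEdge t ≢ rightEdge t
    consecutive-edges-distinct eq =
      shared (joins P _ _ (left-mid t)) (subst (λ e → Joins H e _ _) (sym eq) (joins P _ _ (mid-right t)))
      where
      l≢m = vert-distinct (ℕₚ.<⇒≢ l<m)
      m≢r = vert-distinct (ℕₚ.<⇒≢ m<r)
      shared : ∀ {e} → Joins H e (vert P (left t)) (vert P (mid t)) →
               Joins H e (vert P (mid t)) (vert P (right t)) → ⊥
      shared (inj₁ p) (inj₁ q) = l≢m (cong proj₁ (trans (sym p) q))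
      shared (inj₁ p) (inj₂ q) = ends-distinct (cong proj₁ (trans (sym p) q))
      shared (inj₂ p) (inj₁ q) = ends-distinct (cong proj₂ (trans (sym p) q))
      shared (inj₂ p) (inj₂ q) = m≢r (cong proj₁ (trans (sym p) q))

  Linked⇒¬FFree : ∀ {f i j p i' j' p'} → Linked f (edg P i j p) (edg P i' j' p') → ¬ FFree f P
  Linked⇒¬FFree (inj₁ hit) free = free _ _ _ _ _ _ hit
  Linked⇒¬FFree (inj₂ hit) free = free _ _ _ _ _ _ hit

prefix : ∀ {n K} {H : Graph n} → PathCopy H (suc K) → PathCopy H K
prefix P = record
  { vert    = vert P ∘ inject₁
  ; vertInj = Finₚ.inject₁-injective ∘ vertInj P
  ; edg     = λ i j p → edg P (inject₁ i) (inject₁ j) (inject₁-step i j p)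
  ; joins   = λ i j p → joins P (inject₁ i) (inject₁ j) (inject₁-step i j p)
  }
  where
  inject₁-step : ∀ {K} (i j : Fin K) → toℕ j ≡ suc (toℕ i) → toℕ (inject₁ j) ≡ suc (toℕ (inject₁ i))
  inject₁-step i j p = trans (Finₚ.toℕ-inject₁ j) (trans p (cong suc (sym (Finₚ.toℕ-inject₁ i))))

Admissible-suc : ∀ {n K} {H : Graph n} → Admissible K H → Admissible (suc K) H
Admissible-suc (f , f-fpf , no-free) = f , f-fpf , λ P free → no-free (prefix P) (λ _ _ _ _ _ _ → free _ _ _ _ _ _)

hGe-suc : ∀ n K → hGe n (suc K) K
hGe-suc n K H admissible = H , ℕₚ.≤-refl , Admissible-suc admissible

hAtLeast-zero : ∀ {n K} → 2 ≤ K → hAtLeast n K 0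
hAtLeast-zero {n} (s≤s (s≤s z≤n)) = emptyGraph n , z≤n , (λ ()) , (λ ()) , λ P _ → Finₚ.¬Fin0 (edg P 0F 1F refl)

hAtLeast-from : ∀ {K} m (b : ℕ → ℕ) → 2 ≤ K → (∀ {n} → n < m → b n ≡ 0) →
  ((k : ℕ) → hAtLeast (m + k) K (b (m + k))) → (n : ℕ) → hAtLeast n K (b n)
hAtLeast-from {K} m b 2≤K vanish large n with m ≤? n
... | yes m≤n = subst (λ n → hAtLeast n K (b n)) (ℕₚ.m+[n∸m]≡n m≤n) (large (n ∸ m))
... | no m≰n  = subst (hAtLeast n K) (sym (vanish (ℕₚ.≰⇒> m≰n))) (hAtLeast-zero 2≤K)

module Enumerated {n N} {E : Set} (enumeration : Fin N ↔ E) (ends : E → Fin n × Fin n)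
  (ends-ordered : ∀ x → proj₁ (ends x) <ᶠ proj₂ (ends x)) (ends-injective : Injective _≡_ _≡_ ends) where

  open Inverse enumeration public using (to)
  open Inverse enumeration using (from; strictlyInverseˡ; strictlyInverseʳ)

  to-injective : Injective _≡_ _≡_ to
  to-injective = Injection.injective (Inverse⇒Injection enumeration)

  graph : Graph n
  graph = record
    { nEdges = N ; edge = ends ∘ to ; ordered = ends-ordered ∘ to ; distinct = to-injective ∘ ends-injective }

  conjugate : (E → E) → Fin N → Fin N
  conjugate φ = from ∘ φ ∘ to

  conjugate-fpf : ∀ {φ} → (∀ x → φ x ≢ x) → ∀ e → conjugate φ e ≢ e
  conjugate-fpf {φ} φ-fpf e eq = φ-fpf (to e) (trans (sym (strictlyInverseˡ (φ (to e)))) (cong to eq))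

  Linked-conjugate : ∀ {φ e e'} → Linked φ (to e) (to e') → Linked (conjugate φ) e e'
  Linked-conjugate (inj₁ hit) = inj₁ (trans (cong from hit) (strictlyInverseʳ _))
  Linked-conjugate (inj₂ hit) = inj₂ (trans (cong from hit) (strictlyInverseʳ _))

pattern inner e   = inj₁ e
pattern cross a b = inj₂ (a , b)

module Join {m : ℕ} (G : Graph m) (k : ℕ) where

  inA : Fin m → Fin (m + k)
  inA a = a ↑ˡ k

  inB : Fin k → Fin (m + k)
  inB b = m ↑ʳ b

  inA-injective : ∀ {a a'} → inA a ≡ inA a' → a ≡ a'
  inA-injective = Finₚ.↑ˡ-injective k _ _

  inB-injective : ∀ {b b'} → inB b ≡ inB b' → b ≡ b'
  inB-injective = Finₚ.↑ʳ-injective m _ _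

  inA≢inB : ∀ {a b} → inA a ≢ inB b
  inA≢inB {a} {b} eq
    with trans (sym (Finₚ.splitAt-↑ˡ m a k)) (trans (cong (splitAt m) eq) (Finₚ.splitAt-↑ʳ m k b))
  ... | ()

  side : (v : Fin (m + k)) → (∃[ a ] v ≡ inA a) ⊎ (∃[ b ] v ≡ inB b)
  side v with splitAt m v in eq
  ... | inj₁ a = inj₁ (a , sym (Finₚ.splitAt⁻¹-↑ˡ eq))
  ... | inj₂ b = inj₂ (b , sym (Finₚ.splitAt⁻¹-↑ʳ eq))

  JoinEdge : Set
  JoinEdge = Fin (nEdges G) ⊎ (Fin m × Fin k)

  ends : JoinEdge → Fin (m + k) × Fin (m + k)
  ends (inner e)   = inA (proj₁ (edge G e)) , inA (proj₂ (edge G e))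
  ends (cross a b) = inA a , inB b

  ends-ordered : ∀ x → proj₁ (ends x) <ᶠ proj₂ (ends x)
  ends-ordered (inner e) rewrite Finₚ.toℕ-↑ˡ (proj₁ (edge G e)) k | Finₚ.toℕ-↑ˡ (proj₂ (edge G e)) k =
    ordered G e
  ends-ordered (cross a b) rewrite Finₚ.toℕ-↑ˡ a k | Finₚ.toℕ-↑ʳ {k} m b =
    ℕₚ.<-≤-trans (Finₚ.toℕ<n a) (ℕₚ.m≤m+n m (toℕ b))

  ends-injective : Injective _≡_ _≡_ ends
  ends-injective {inner e} {inner e'} eq with ,-injective eq
  ... | p , q = cong inj₁ (distinct G (cong₂ _,_ (inA-injective p) (inA-injective q)))
  ends-injective {inner _} {cross _ _} eq = ⊥-elim (inA≢inB (proj₂ (,-injective eq)))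
  ends-injective {cross _ _} {inner _} eq = ⊥-elim (inA≢inB (sym (proj₂ (,-injective eq))))
  ends-injective {cross a b} {cross a' b'} eq with ,-injective eq
  ... | p , q rewrite inA-injective p | inB-injective q = refl

  enumeration : Fin (nEdges G + m * k) ↔ JoinEdge
  enumeration = ↔-trans Finₚ.+↔⊎ (↔-refl ⊎-↔ Finₚ.*↔×)

  open Enumerated enumeration ends ends-ordered ends-injective public

  data JoinsAt (x : JoinEdge) (u v : Fin (m + k)) : Set where
    forward  : ends x ≡ (u , v) → JoinsAt x u v
    backward : ends x ≡ (v , u) → JoinsAt x u v

  JoinsAt-sym : ∀ {x u v} → JoinsAt x u v → JoinsAt x v u
  JoinsAt-sym (forward p)  = backward p
  JoinsAt-sym (backward p) = forward p

  joinsAt : ∀ {K} (P : PathCopy graph K) i j p → JoinsAt (to (edg P i j p)) (vert P i) (vert P j)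
  joinsAt P i j p with joins P i j p
  ... | inj₁ p = forward p
  ... | inj₂ p = backward p

  joins-inB : ∀ {x u v b} → JoinsAt x u v → v ≡ inB b → ∃[ a ] (x ≡ cross a b × u ≡ inA a)
  joins-inB {inner _}   (forward p) refl = ⊥-elim (inA≢inB (cong proj₂ p))
  joins-inB {inner _}   (backward p) refl = ⊥-elim (inA≢inB (cong proj₁ p))
  joins-inB {cross a _} (forward p) refl rewrite inB-injective (cong proj₂ p) = a , refl , sym (cong proj₁ p)
  joins-inB {cross _ _} (backward p) refl = ⊥-elim (inA≢inB (cong proj₁ p))

  joins-inA-inA : ∀ {x u v a a'} → JoinsAt x u v → u ≡ inA a → v ≡ inA a' → ∃[ e ] x ≡ inner e
  joins-inA-inA {inner e}   _        _    _    = e , refl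
  joins-inA-inA {cross _ _} (forward p) refl refl = ⊥-elim (inA≢inB (sym (cong proj₂ p)))
  joins-inA-inA {cross _ _} (backward p) refl refl = ⊥-elim (inA≢inB (sym (cong proj₂ p)))

  joins-inA : ∀ {x u v} → JoinsAt x u v → (∃[ a ] u ≡ inA a) ⊎ (∃[ a ] v ≡ inA a)
  joins-inA {v = v} j with side v
  ... | inj₁ v-inA      = inj₂ v-inA
  ... | inj₂ (_ , v-inB) = inj₁ (_ , proj₂ (proj₂ (joins-inB j v-inB)))

  edgeless⇒joins-inA-inB : ¬ Fin (nEdges G) → ∀ {x u v a} → JoinsAt x u v → u ≡ inA a → ∃[ b ] v ≡ inB b
  edgeless⇒joins-inA-inB edgeless {v = v} j u-inA with side v
  ... | inj₂ v-inB      = v-inB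
  ... | inj₁ (_ , v-inA) = ⊥-elim (edgeless (proj₁ (joins-inA-inA j u-inA v-inA)))

  module Shift (τ : Fin (nEdges G) → Fin (nEdges G)) (τ-fpf : ∀ e → τ e ≢ e)
               (σ : Fin m → Fin m) (σ-fpf : ∀ a → σ a ≢ a) where

    shift : JoinEdge → JoinEdge
    shift (inner e)   = inner (τ e)
    shift (cross a b) = cross (σ a) b

    shift-fpf : ∀ x → shift x ≢ x
    shift-fpf (inner e)   eq = τ-fpf e (cong (λ { (inner e') → e' ; _ → e }) eq)
    shift-fpf (cross a b) eq = σ-fpf a (cong (λ { (cross a' _) → a' ; _ → a }) eq)

    f : Fin (nEdges graph) → Fin (nEdges graph)
    f = conjugate shift

    module _ {K} (P : PathCopy graph K) (t : Triple K) where

      Linked-shift⇒¬FFree : Linked shift (to (leftEdge P t)) (to (rightEdge P t)) → ¬ FFree f P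
      Linked-shift⇒¬FFree = Linked⇒¬FFree P {f = f} ∘ Linked-conjugate {φ = shift}

      cherry-¬FFree : ∀ {b} → vert P (mid t) ≡ inB b →
        (∀ {a a'} → a ≢ a' → vert P (left t) ≡ inA a → vert P (right t) ≡ inA a' → Linked σ a a') →
        ¬ FFree f P
      cherry-¬FFree {b} mid-inB σ-links
        with joins-inB (joinsAt P _ _ (left-mid t)) mid-inB
           | joins-inB (JoinsAt-sym (joinsAt P _ _ (mid-right t))) mid-inB
      ... | a , l-cross , l-inA | a' , r-cross , r-inA =
        Linked-shift⇒¬FFree (subst₂ (Linked shift) (sym l-cross) (sym r-cross)
          (Linked-map {ψ = shift} (λ z → cross z b) (λ _ → refl) (σ-links a≢a' l-inA r-inA)))
        where
        a≢a' : a ≢ a'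
        a≢a' a≡a' = ends-distinct P t (trans l-inA (trans (cong inA a≡a') (sym r-inA)))

      inner-¬FFree : ∀ {e e'} → to (leftEdge P t) ≡ inner e → to (rightEdge P t) ≡ inner e' →
        Linked τ e e' → ¬ FFree f P
      inner-¬FFree l-inner r-inner =
        Linked-shift⇒¬FFree ∘ subst₂ (Linked shift) (sym l-inner) (sym r-inner)
                            ∘ Linked-map {ψ = shift} inner (λ _ → refl)

rotate : Fin 3 → Fin 3
rotate 0F = 1F
rotate 1F = 2F
rotate 2F = 0F

rotate-fpf : ∀ a → rotate a ≢ a
rotate-fpf 0F ()
rotate-fpf 1F ()
rotate-fpf 2F ()

rotate-links : ∀ {a a'} → a ≢ a' → Linked rotate a a'
rotate-links {0F} {0F} a≢a' = ⊥-elim (a≢a' refl)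
rotate-links {0F} {1F} _    = inj₁ refl
rotate-links {0F} {2F} _    = inj₂ refl
rotate-links {1F} {0F} _    = inj₂ refl
rotate-links {1F} {1F} a≢a' = ⊥-elim (a≢a' refl)
rotate-links {1F} {2F} _    = inj₁ refl
rotate-links {2F} {0F} _    = inj₁ refl
rotate-links {2F} {1F} _    = inj₂ refl
rotate-links {2F} {2F} a≢a' = ⊥-elim (a≢a' refl)

triangleEdge : Fin 3 → Fin 3 × Fin 3
triangleEdge 0F = 0F , 1F
triangleEdge 1F = 1F , 2F
triangleEdge 2F = 0F , 2F

triangle : Graph 3
triangle = record
  { nEdges   = 3
  ; edge     = triangleEdge
  ; ordered  = λ { 0F → s≤s z≤n ; 1F → s≤s (s≤s z≤n) ; 2F → s≤s z≤n }
  ; distinct = λ {e} {e'} eq → trans (sym (label-edge e)) (trans (cong label eq) (label-edge e'))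
  }
  where
  label : Fin 3 × Fin 3 → Fin 3
  label (0F , 1F) = 0F
  label (1F , _)  = 1F
  label _         = 2F
  label-edge : ∀ e → label (triangleEdge e) ≡ e
  label-edge 0F = refl
  label-edge 1F = refl
  label-edge 2F = refl

module P₄ (k : ℕ) where
  open Join (emptyGraph 3) k
  open Shift (λ ()) (λ ()) rotate rotate-fpf

  cherry : ∀ {K} (P : PathCopy graph K) t {b} → vert P (mid t) ≡ inB b → ¬ FFree f P
  cherry P t v = cherry-¬FFree P t v (λ a≢a' _ _ → rotate-links a≢a')

  admissible : Admissible 4 graph
  admissible = f , conjugate-fpf shift-fpf , no-free
    where
    no-free : (P : PathCopy graph 4) → ¬ FFree f P
    no-free P with side (vert P 1F)
    ... | inj₂ (_ , v₁) = cherry P (triple 0F 1F 2F refl refl) v₁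
    ... | inj₁ (_ , v₁) with edgeless⇒joins-inA-inB (λ ()) (joinsAt P 1F 2F refl) v₁
    ...   | _ , v₂ = cherry P (triple 1F 2F 3F refl refl) v₂

module P₅ (k : ℕ) where
  open Join triangle k
  open Shift rotate rotate-fpf rotate rotate-fpf

  cherry : ∀ {K} (P : PathCopy graph K) t {b} → vert P (mid t) ≡ inB b → ¬ FFree f P
  cherry P t v = cherry-¬FFree P t v (λ a≢a' _ _ → rotate-links a≢a')

  admissible : Admissible 5 graph
  admissible = f , conjugate-fpf shift-fpf , no-free
    where
    no-free : (P : PathCopy graph 5) → ¬ FFree f P
    no-free P with side (vert P 1F) | side (vert P 2F) | side (vert P 3F)
    ... | inj₂ (_ , v₁) | _ | _ = cherry P (triple 0F 1F 2F refl refl) v₁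
    ... | _ | inj₂ (_ , v₂) | _ = cherry P (triple 1F 2F 3F refl refl) v₂
    ... | _ | _ | inj₂ (_ , v₃) = cherry P (triple 2F 3F 4F refl refl) v₃
    ... | inj₁ (_ , v₁) | inj₁ (_ , v₂) | inj₁ (_ , v₃)
      with joins-inA-inA (joinsAt P 1F 2F refl) v₁ v₂ | joins-inA-inA (joinsAt P 2F 3F refl) v₂ v₃
    ...   | _ , l-inner | _ , r-inner =
      inner-¬FFree P t l-inner r-inner (rotate-links (λ e≡e' →
        consecutive-edges-distinct P t (to-injective (trans l-inner (trans (cong inner e≡e') (sym r-inner))))))
      where t = triple 1F 2F 3F refl refl

module EvenPath (r k : ℕ) where
  M : ℕ
  M = suc (suc r)

  toZero : Fin M → Fin M
  toZero 0F      = 1F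
  toZero (suc _) = 0F

  toZero-fpf : ∀ a → toZero a ≢ a
  toZero-fpf 0F ()
  toZero-fpf (suc _) ()

  toZero-nonzero : ∀ {a} → a ≢ 0F → toZero a ≡ 0F
  toZero-nonzero {0F}    a≢0 = ⊥-elim (a≢0 refl)
  toZero-nonzero {suc _} _   = refl

  pair : Fin M → Fin 2 → Fin (2 * M)
  pair t i = cast (ℕₚ.*-comm M 2) (combine t i)

  toℕ-pair : ∀ t i → toℕ (pair t i) ≡ 2 * toℕ t + toℕ i
  toℕ-pair t i = trans (Finₚ.toℕ-cast _ (combine t i)) (Finₚ.toℕ-combine t i)

  pair-consecutive : ∀ t → toℕ (pair t 1F) ≡ suc (toℕ (pair t 0F))
  pair-consecutive t = begin
    toℕ (pair t 1F)        ≡⟨ toℕ-pair t 1F ⟩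
    2 * toℕ t + 1          ≡⟨ ℕₚ.+-comm (2 * toℕ t) 1 ⟩
    suc (2 * toℕ t)        ≡⟨ cong suc (sym (ℕₚ.+-identityʳ _)) ⟩
    suc (2 * toℕ t + 0)    ≡⟨ cong suc (sym (toℕ-pair t 0F)) ⟩
    suc (toℕ (pair t 0F))  ∎
    where open ≡-Reasoning

  pair-injectiveˡ : ∀ {t t' i i'} → pair t i ≡ pair t' i' → t ≡ t'
  pair-injectiveˡ {t} {t'} {i} {i'} eq = proj₁ (Finₚ.combine-injective t i t' i' (Finₚ.toℕ-injective (begin
    toℕ (combine t i)   ≡⟨ sym (Finₚ.toℕ-cast _ (combine t i)) ⟩
    toℕ (pair t i)      ≡⟨ cong toℕ eq ⟩
    toℕ (pair t' i')    ≡⟨ Finₚ.toℕ-cast _ (combine t' i') ⟩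
    toℕ (combine t' i') ∎)))
    where open ≡-Reasoning

  4≤2*M : 4 ≤ 2 * M
  4≤2*M = ℕₚ.*-monoʳ-≤ 2 (s≤s (s≤s z≤n))

  open Join (emptyGraph M) k
  open Shift (λ ()) (λ ()) toZero toZero-fpf

  module _ (P : PathCopy graph (2 * M)) (free : FFree f P) where

    inA-zero-avoided : ∀ q → vert P q ≢ inA 0F
    inA-zero-avoided q q-inA with triple-around 4≤2*M q
    ... | t , inj₁ refl with edgeless⇒joins-inA-inB (λ ()) (joinsAt P _ _ (left-mid t)) q-inA
    ...   | _ , mid-inB = cherry-¬FFree P t mid-inB links free
      where
      links : ∀ {a a'} → a ≢ a' → vert P (left t) ≡ inA a → vert P (right t) ≡ inA a' → Linked toZero a a'
      links a≢a' l-inA _ with inA-injective (trans (sym l-inA) q-inA)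
      ... | refl = inj₂ (toZero-nonzero (a≢a' ∘ sym))
    inA-zero-avoided q q-inA | t , inj₂ refl
      with edgeless⇒joins-inA-inB (λ ()) (JoinsAt-sym (joinsAt P _ _ (mid-right t))) q-inA
    ...   | _ , mid-inB = cherry-¬FFree P t mid-inB links free
      where
      links : ∀ {a a'} → a ≢ a' → vert P (left t) ≡ inA a → vert P (right t) ≡ inA a' → Linked toZero a a'
      links a≢a' _ r-inA with inA-injective (trans (sym r-inA) q-inA)
      ... | refl = inj₁ (toZero-nonzero a≢a')

    inA-in-pair : ∀ t → Σ[ i ∈ Fin 2 ] ∃[ a ] vert P (pair t i) ≡ inA a
    inA-in-pair t with joins-inA (joinsAt P (pair t 0F) (pair t 1F) (pair-consecutive t))
    ... | inj₁ v₀ = 0F , v₀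
    ... | inj₂ v₁ = 1F , v₁

    label : Fin M → Fin M
    label t = proj₁ (proj₂ (inA-in-pair t))

    label-nonzero : ∀ t → 0F ≢ label t
    label-nonzero t 0≡label = inA-zero-avoided _ (trans (proj₂ (proj₂ (inA-in-pair t))) (cong inA (sym 0≡label)))

    label-injective : Injective _≡_ _≡_ label
    label-injective {t} {t'} eq with inA-in-pair t | inA-in-pair t'
    ... | _ , _ , v | _ , _ , v' = pair-injectiveˡ (vertInj P (trans v (trans (cong inA eq) (sym v'))))

    label-pigeonhole : ⊥
    label-pigeonhole = ℕₚ.1+n≰n (Finₚ.injective⇒≤ {f = λ t → punchOut (label-nonzero t)}
      (label-injective ∘ Finₚ.punchOut-injective (label-nonzero _) (label-nonzero _)))

  admissible : Admissible (2 * M) graph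
  admissible = f , conjugate-fpf shift-fpf , label-pigeonhole

proposition3p4 :
    ((n : ℕ) → hAtLeast n 4 (3 * (n ∸ 3)))
    × ((n : ℕ) → hGe n 7 6 × hGe n 6 5 × hAtLeast n 5 (3 * n ∸ 6))
    × ((m : ℕ) → 4 ≤ m → (n : ℕ) →
        hGe n (suc (2 * m)) (2 * m) × hAtLeast n (2 * m) (m * (n ∸ m)))
proposition3p4 = P₄-bound , (λ n → hGe-suc n 6 , hGe-suc n 5 , P₅-bound n) , P₂ₘ-bounds
  where
  P₄-bound : (n : ℕ) → hAtLeast n 4 (3 * (n ∸ 3))
  P₄-bound = hAtLeast-from 3 (λ n → 3 * (n ∸ 3)) (s≤s (s≤s z≤n))
    (λ n<3 → cong (3 *_) (ℕₚ.m≤n⇒m∸n≡0 (ℕₚ.<⇒≤ n<3)))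
    (λ k → _ , ℕₚ.≤-refl , P₄.admissible k)

  P₅-bound : (n : ℕ) → hAtLeast n 5 (3 * n ∸ 6)
  P₅-bound = hAtLeast-from 3 (λ n → 3 * n ∸ 6) (s≤s (s≤s z≤n))
    (λ n<3 → ℕₚ.m≤n⇒m∸n≡0 (ℕₚ.*-monoʳ-≤ 3 (ℕₚ.≤-pred n<3)))
    (λ k → _ , ℕₚ.≤-reflexive (cong (_∸ 6) (ℕₚ.*-distribˡ-+ 3 3 k)) , P₅.admissible k)

  P₂ₘ-bounds : (m : ℕ) → 4 ≤ m → (n : ℕ) → hGe n (suc (2 * m)) (2 * m) × hAtLeast n (2 * m) (m * (n ∸ m))
  P₂ₘ-bounds m@(suc (suc r)) (s≤s (s≤s _)) n =
    hGe-suc n (2 * m) , hAtLeast-from m (λ n → m * (n ∸ m)) (s≤s (s≤s z≤n))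
    (λ n<m → trans (cong (m *_) (ℕₚ.m≤n⇒m∸n≡0 (ℕₚ.<⇒≤ n<m))) (ℕₚ.*-zeroʳ m))
    (λ k → _ , ℕₚ.≤-reflexive (cong (m *_) (ℕₚ.m+n∸m≡n m k)) , EvenPath.admissible r k) n
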